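{- Let $n,k$ be integers with $k\ge 2$ and $n\ge 2k$. Then $\beta_E(J_{n,k}) \ge MHSP(F_{J_{n,k}})$, where $MHSP(F_{J_{n,k}})$ is the minimal cardinality of a set $H\subseteq V(J_{n,k})$ having nonempty intersection with every member of the family $F=\{\overline{S_{x,y,z}'} : x,y,z\in[n] \text{ mutually distinct}\}$.
   Context: $[n]=\{1,\dots,n\}$. The Johnson graph $J_{n,k}$ has as vertices all $k$-element subsets of $[n]$, two of them $A,B$ being adjacent iff $|A\cap B|=k-1$; the graph distance is $d(A,B)=k-|A\cap B|$. For an edge $e=uv$ and a vertex $w$, $d(e,w)=\min\{d(u,w),d(v,w)\}$. A set $N\subseteq V(G)$ is an edge resolving set of a connected graph $G$ if for every two distinct edges $e_1,e_2$ there is $w\in N$ with $d(e_1,w)\ne d(e_2,w)$; the edge metric dimension $\beta_E(G)$ is the minimum cardinality of an edge resolving set. For mutually distinct $x,y,z\in[n]$, $\overline{S_{x,y,z}'}=\{\{x,z\} \cup T,\ \{y,z\} \cup T : T \subset [n] \setminus \{x,y,z\},\ |T|=k-2\}\subseteq V(J_{n,k})$. The paper considers Johnson graphs only with $n\ge 2k$. -}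

module Defs where

open import Data.Nat using (ℕ; _≤_; _∸_; _⊓_)
open import Data.Fin using (Fin)
open import Data.Fin.Subset using (Subset; ∣_∣; _∩_; _∪_; ⁅_⁆; _∈_; Empty)
open import Data.List using (List; length)
import Data.List.Membership.Propositional as LM
open import Data.List.Relation.Unary.Unique.Propositional using (Unique)
open import Data.Product using (Σ; ∃; _×_; _,_; proj₁)
open import Data.Sum using (_⊎_)
open import Relation.Binary.PropositionalEquality using (_≡_; _≢_)
open import Relation.Nullary using (¬_)

Vertex : ℕ → ℕ → Set
Vertex n k = Σ (Subset n) (λ A → ∣ A ∣ ≡ k)

dist : ∀ {n k} → Vertex n k → Vertex n k → ℕ
dist {k = k} (A , _) (B , _) = k ∸ ∣ A ∩ B ∣

Adjacent : ∀ {n k} → Vertex n k → Vertex n k → Set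
Adjacent {k = k} (A , _) (B , _) = ∣ A ∩ B ∣ ≡ k ∸ 1

-- An edge, represented by an (ordered) adjacent pair of vertices.
Edge : ℕ → ℕ → Set
Edge n k = Σ (Vertex n k × Vertex n k) (λ p → Adjacent (proj₁ p) (Data.Product.proj₂ p))

SameEdge : ∀ {n k} → Edge n k → Edge n k → Set
SameEdge ((u₁ , v₁) , _) ((u₂ , v₂) , _) = (u₁ ≡ u₂ × v₁ ≡ v₂) ⊎ (u₁ ≡ v₂ × v₁ ≡ u₂)

edgeDist : ∀ {n k} → Edge n k → Vertex n k → ℕ
edgeDist ((u , v) , _) w = dist u w ⊓ dist v w

record VertexSet (n k : ℕ) : Set where
  constructor vset
  field
    elems  : List (Vertex n k)
    unique : Unique elems
open VertexSet public

card : ∀ {n k} → VertexSet n k → ℕ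
card N = length (elems N)

_∈V_ : ∀ {n k} → Vertex n k → VertexSet n k → Set
w ∈V N = w LM.∈ elems N

IsEdgeResolving : ∀ {n k} → VertexSet n k → Set
IsEdgeResolving {n} {k} N =
  (e₁ e₂ : Edge n k) → ¬ SameEdge e₁ e₂ →
  ∃ λ w → w ∈V N × edgeDist e₁ w ≢ edgeDist e₂ w

IsEdgeMetricDim : ℕ → ℕ → ℕ → Set
IsEdgeMetricDim n k b =
  (∃ λ (N : VertexSet n k) → IsEdgeResolving N × card N ≡ b) ×
  ((N : VertexSet n k) → IsEdgeResolving N → b ≤ card N)

InS' : ∀ {n k} → Fin n → Fin n → Fin n → Vertex n k → Set
InS' {n} {k} x y z (A , _) =
  ∃ λ (T : Subset n) →
    Empty (T ∩ (⁅ x ⁆ ∪ (⁅ y ⁆ ∪ ⁅ z ⁆))) × ∣ T ∣ ≡ k ∸ 2 ×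
    (A ≡ (⁅ x ⁆ ∪ ⁅ z ⁆) ∪ T ⊎ A ≡ (⁅ y ⁆ ∪ ⁅ z ⁆) ∪ T)

IsHittingSet : ∀ {n k} → VertexSet n k → Set
IsHittingSet {n} {k} H =
  (x y z : Fin n) → x ≢ y → x ≢ z → y ≢ z →
  ∃ λ w → w ∈V H × InS' x y z w

IsMHSP : ℕ → ℕ → ℕ → Set
IsMHSP n k m =
  (∃ λ (H : VertexSet n k) → IsHittingSet H × card H ≡ m) ×
  ((H : VertexSet n k) → IsHittingSet H → m ≤ card H)

-- For mutually distinct x, y, z choose R ⊆ [n] ∖ {x, y, z} with |R| = k - 2, which n ≥ 2k
-- allows, and put A = {y,z} ∪ R, B = {x,y} ∪ R, C = {x,z} ∪ R. Then AB and CB are two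
-- distinct edges of J_{n,k}. Since d(·, W) = k - |· ∩ W|, a vertex W resolves them only if
-- z ∈ W (otherwise B is the nearer end of both edges) and exactly one of x, y lies in W
-- (otherwise |A ∩ W| = |C ∩ W|); such a W lies in \overline{S'_{x,y,z}}. So every edge
-- resolving set hits every member of F, and is at least as large as a minimum hitting set.
module Submission where

open import Data.Nat using (ℕ; zero; suc; _≤_; _*_; _+_; _∸_; _⊓_; z≤n; s≤s)
open import Data.Nat.Properties
  using (≤-trans; ≤-reflexive; +-comm; +-suc; +-identityʳ; +-monoˡ-≤; +-monoʳ-≤;
         m≤m+n; m≤n+m; m≥n⇒m⊓n≡n; ∸-monoʳ-≤; m+n≤o⇒m≤o∸n; m+n∸m≡n; m+[n∸m]≡n; +-∸-assoc)
open import Data.Fin using (Fin; zero)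
open import Data.Fin.Subset
  using (Subset; inside; outside; _∈_; _∉_; _⊆_; _∩_; _∪_; ∁; ⁅_⁆; ⊥; ⊤; ∣_∣; Empty)
open import Data.Fin.Subset.Properties
  using (_∈?_; ∉⊥; ⊥⊆; ∣⊥∣≡0; x∈⁅x⁆; x∈⁅y⁆⇒x≡y; x≢y⇒x∉⁅y⁆; ∣⁅x⁆∣≡1; ⊆-refl; ⊆-antisym;
         s⊆s; drop-∷-Empty; Empty-unique; x∈∁p⇒x∉p; ∣∁p∣≡n∸∣p∣; p∩q⊆p; p∩q⊆q; x∈p∩q⁺;
         x∈p∩q⁻; x∈p∪q⁺; x∈p∪q⁻; q⊆p∪q; ∩-comm; ∩-identityʳ; ∩-inverseʳ; ∪-inverseʳ;
         ∪-identityˡ; ∩-distribˡ-∪; ∩-distribʳ-∪)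
open import Data.Vec using ([]; _∷_; here)
open import Data.Product using (∃; _×_; _,_; proj₁)
open import Data.Sum using (_⊎_; inj₁; inj₂; [_,_])
open import Relation.Nullary using (¬_; yes; no; contradiction)
open import Relation.Binary.PropositionalEquality
  using (_≡_; _≢_; ≢-sym; refl; sym; trans; cong; cong₂; subst; module ≡-Reasoning)
open ≡-Reasoning

open import Defs

private
  variable
    n : ℕ
    p q r p′ q′ : Subset n
    x y : Fin n

Empty-⊥ : Empty (⊥ {n})
Empty-⊥ (_ , x∈⊥) = ∉⊥ x∈⊥

Empty-∩-mono : p′ ⊆ p → q′ ⊆ q → Empty (p ∩ q) → Empty (p′ ∩ q′)
Empty-∩-mono {p′ = p′} {q′ = q′} p′⊆p q′⊆q p∩q-empty (x , x∈p′∩q′) =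
  let x∈p′ , x∈q′ = x∈p∩q⁻ p′ q′ x∈p′∩q′
  in p∩q-empty (x , x∈p∩q⁺ (p′⊆p x∈p′ , q′⊆q x∈q′))

⊆-∁⇒Empty-∩ : p ⊆ q → r ⊆ ∁ q → Empty (p ∩ r)
⊆-∁⇒Empty-∩ {q = q} p⊆q r⊆∁q =
  Empty-∩-mono p⊆q r⊆∁q (subst Empty (sym (∩-inverseʳ q)) Empty-⊥)

x∉p∪q : x ∉ p → x ∉ q → x ∉ p ∪ q
x∉p∪q {p = p} {q = q} x∉p x∉q x∈p∪q = [ x∉p , x∉q ] (x∈p∪q⁻ p q x∈p∪q)

⁅x⁆∪⁅y⁆⊆p : x ∈ p → y ∈ p → ⁅ x ⁆ ∪ ⁅ y ⁆ ⊆ p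
⁅x⁆∪⁅y⁆⊆p {x = x} {p = p} {y = y} x∈p y∈p z∈⁅x⁆∪⁅y⁆ =
  [ (λ z∈⁅x⁆ → subst (_∈ p) (sym (x∈⁅y⁆⇒x≡y x z∈⁅x⁆)) x∈p)
  , (λ z∈⁅y⁆ → subst (_∈ p) (sym (x∈⁅y⁆⇒x≡y y z∈⁅y⁆)) y∈p)
  ] (x∈p∪q⁻ ⁅ x ⁆ ⁅ y ⁆ z∈⁅x⁆∪⁅y⁆)

p⊆q⇒p∩q≡p : p ⊆ q → p ∩ q ≡ p
p⊆q⇒p∩q≡p {p = p} {q = q} p⊆q = ⊆-antisym (p∩q⊆p p q) (λ x∈p → x∈p∩q⁺ (x∈p , p⊆q x∈p))

p≡[p∩q]∪[p∩∁q] : ∀ (p q : Subset n) → p ≡ (p ∩ q) ∪ (p ∩ ∁ q)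
p≡[p∩q]∪[p∩∁q] p q = begin
  p                       ≡⟨ sym (∩-identityʳ p) ⟩
  p ∩ ⊤                   ≡⟨ cong (p ∩_) (sym (∪-inverseʳ q)) ⟩
  p ∩ (q ∪ ∁ q)           ≡⟨ ∩-distribˡ-∪ p q (∁ q) ⟩
  (p ∩ q) ∪ (p ∩ ∁ q)     ∎

x∈p⇒⁅x⁆∩p≡⁅x⁆ : x ∈ p → ⁅ x ⁆ ∩ p ≡ ⁅ x ⁆
x∈p⇒⁅x⁆∩p≡⁅x⁆ {x = x} {p = p} x∈p =
  ⊆-antisym (p∩q⊆p ⁅ x ⁆ p)
            (λ y∈⁅x⁆ → x∈p∩q⁺ (y∈⁅x⁆ , subst (_∈ p) (sym (x∈⁅y⁆⇒x≡y x y∈⁅x⁆)) x∈p))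

x∉p⇒⁅x⁆∩p≡⊥ : x ∉ p → ⁅ x ⁆ ∩ p ≡ ⊥
x∉p⇒⁅x⁆∩p≡⊥ {x = x} {p = p} x∉p = Empty-unique λ (y , y∈⁅x⁆∩p) →
  let y∈⁅x⁆ , y∈p = x∈p∩q⁻ ⁅ x ⁆ p y∈⁅x⁆∩p
  in x∉p (subst (_∈ p) (x∈⁅y⁆⇒x≡y x y∈⁅x⁆) y∈p)

x∉p⇒Empty[⁅x⁆∩p] : x ∉ p → Empty (⁅ x ⁆ ∩ p)
x∉p⇒Empty[⁅x⁆∩p] x∉p = subst Empty (sym (x∉p⇒⁅x⁆∩p≡⊥ x∉p)) Empty-⊥

∣⁅x⁆∩p∣≡1 : x ∈ p → ∣ ⁅ x ⁆ ∩ p ∣ ≡ 1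
∣⁅x⁆∩p∣≡1 {x = x} x∈p = trans (cong ∣_∣ (x∈p⇒⁅x⁆∩p≡⁅x⁆ x∈p)) (∣⁅x⁆∣≡1 x)

∣⁅x⁆∩p∣≡0 : ∀ {n} {x : Fin n} {p} → x ∉ p → ∣ ⁅ x ⁆ ∩ p ∣ ≡ 0
∣⁅x⁆∩p∣≡0 {n} x∉p = trans (cong ∣_∣ (x∉p⇒⁅x⁆∩p≡⊥ x∉p)) (∣⊥∣≡0 n)

∣⁅x⁆∩p∣≢0⇒x∈p : ∣ ⁅ x ⁆ ∩ p ∣ ≢ 0 → x ∈ p
∣⁅x⁆∩p∣≢0⇒x∈p {x = x} {p = p} ≢0 with x ∈? p
... | yes x∈p = x∈p
... | no  x∉p = contradiction (∣⁅x⁆∩p∣≡0 x∉p) ≢0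

∣⁅x⁆∩p∣≢∣⁅y⁆∩p∣ : ∣ ⁅ x ⁆ ∩ p ∣ ≢ ∣ ⁅ y ⁆ ∩ p ∣ → x ∈ p × y ∉ p ⊎ x ∉ p × y ∈ p
∣⁅x⁆∩p∣≢∣⁅y⁆∩p∣ {x = x} {p = p} {y = y} ≢ with x ∈? p | y ∈? p
... | yes x∈p | yes y∈p = contradiction (trans (∣⁅x⁆∩p∣≡1 x∈p) (sym (∣⁅x⁆∩p∣≡1 y∈p))) ≢
... | yes x∈p | no  y∉p = inj₁ (x∈p , y∉p)
... | no  x∉p | yes y∈p = inj₂ (x∉p , y∈p)
... | no  x∉p | no  y∉p = contradiction (trans (∣⁅x⁆∩p∣≡0 x∉p) (sym (∣⁅x⁆∩p∣≡0 y∉p))) ≢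

∣p∪q∣≡∣p∣+∣q∣ : Empty (p ∩ q) → ∣ p ∪ q ∣ ≡ ∣ p ∣ + ∣ q ∣
∣p∪q∣≡∣p∣+∣q∣ {p = []}          {q = []}          _ = refl
∣p∪q∣≡∣p∣+∣q∣ {p = inside  ∷ p} {q = inside  ∷ q} p∩q-empty =
  contradiction (zero , here) p∩q-empty
∣p∪q∣≡∣p∣+∣q∣ {p = inside  ∷ p} {q = outside ∷ q} p∩q-empty =
  cong suc (∣p∪q∣≡∣p∣+∣q∣ (drop-∷-Empty p∩q-empty))
∣p∪q∣≡∣p∣+∣q∣ {p = outside ∷ p} {q = inside  ∷ q} p∩q-empty =
  trans (cong suc (∣p∪q∣≡∣p∣+∣q∣ (drop-∷-Empty p∩q-empty))) (sym (+-suc ∣ p ∣ ∣ q ∣))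
∣p∪q∣≡∣p∣+∣q∣ {p = outside ∷ p} {q = outside ∷ q} p∩q-empty =
  ∣p∪q∣≡∣p∣+∣q∣ (drop-∷-Empty p∩q-empty)

∣[p∪q]∩r∣≡∣p∩r∣+∣q∩r∣ : Empty (p ∩ q) → ∀ r → ∣ (p ∪ q) ∩ r ∣ ≡ ∣ p ∩ r ∣ + ∣ q ∩ r ∣
∣[p∪q]∩r∣≡∣p∩r∣+∣q∩r∣ {p = p} {q = q} p∩q-empty r = begin
  ∣ (p ∪ q) ∩ r ∣          ≡⟨ cong ∣_∣ (∩-distribʳ-∪ r p q) ⟩
  ∣ (p ∩ r) ∪ (q ∩ r) ∣    ≡⟨ ∣p∪q∣≡∣p∣+∣q∣ (Empty-∩-mono (p∩q⊆p p r) (p∩q⊆p q r) p∩q-empty) ⟩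
  ∣ p ∩ r ∣ + ∣ q ∩ r ∣    ∎

∣⁅x⁆∪⁅y⁆∣≡2 : x ≢ y → ∣ ⁅ x ⁆ ∪ ⁅ y ⁆ ∣ ≡ 2
∣⁅x⁆∪⁅y⁆∣≡2 {x = x} {y = y} x≢y = begin
  ∣ ⁅ x ⁆ ∪ ⁅ y ⁆ ∣      ≡⟨ ∣p∪q∣≡∣p∣+∣q∣ (x∉p⇒Empty[⁅x⁆∩p] (x≢y⇒x∉⁅y⁆ x≢y)) ⟩
  ∣ ⁅ x ⁆ ∣ + ∣ ⁅ y ⁆ ∣  ≡⟨ cong₂ _+_ (∣⁅x⁆∣≡1 x) (∣⁅x⁆∣≡1 y) ⟩
  2                      ∎

∣[⁅x⁆∪⁅y⁆]∪p∣≡2+∣p∣ : x ≢ y → Empty ((⁅ x ⁆ ∪ ⁅ y ⁆) ∩ p) → ∣ (⁅ x ⁆ ∪ ⁅ y ⁆) ∪ p ∣ ≡ 2 + ∣ p ∣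
∣[⁅x⁆∪⁅y⁆]∪p∣≡2+∣p∣ {p = p} x≢y disjoint =
  trans (∣p∪q∣≡∣p∣+∣q∣ disjoint) (cong (_+ ∣ p ∣) (∣⁅x⁆∪⁅y⁆∣≡2 x≢y))

∣[⁅x⁆∪⁅y⁆∪p]∩q∣ : x ≢ y → Empty ((⁅ x ⁆ ∪ ⁅ y ⁆) ∩ p) →
  ∀ q → ∣ ((⁅ x ⁆ ∪ ⁅ y ⁆) ∪ p) ∩ q ∣ ≡ ∣ ⁅ x ⁆ ∩ q ∣ + ∣ ⁅ y ⁆ ∩ q ∣ + ∣ p ∩ q ∣
∣[⁅x⁆∪⁅y⁆∪p]∩q∣ {p = p} x≢y disjoint q =
  trans (∣[p∪q]∩r∣≡∣p∩r∣+∣q∩r∣ disjoint q)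
        (cong (_+ ∣ p ∩ q ∣) (∣[p∪q]∩r∣≡∣p∩r∣+∣q∩r∣ (x∉p⇒Empty[⁅x⁆∩p] (x≢y⇒x∉⁅y⁆ x≢y)) q))

∣⁅x⁆∪[⁅y⁆∪⁅z⁆]∣≡3 : ∀ {z} → x ≢ y → x ≢ z → y ≢ z → ∣ ⁅ x ⁆ ∪ (⁅ y ⁆ ∪ ⁅ z ⁆) ∣ ≡ 3
∣⁅x⁆∪[⁅y⁆∪⁅z⁆]∣≡3 {x = x} x≢y x≢z y≢z = trans
  (∣p∪q∣≡∣p∣+∣q∣ (x∉p⇒Empty[⁅x⁆∩p] (x∉p∪q (x≢y⇒x∉⁅y⁆ x≢y) (x≢y⇒x∉⁅y⁆ x≢z))))
  (cong₂ _+_ (∣⁅x⁆∣≡1 x) (∣⁅x⁆∪⁅y⁆∣≡2 y≢z))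

pair-trace⇒split : ∀ {k} → x ≢ y → ∣ p ∣ ≡ k → p ∩ q ≡ ⁅ x ⁆ ∪ ⁅ y ⁆ →
  Empty ((p ∩ ∁ q) ∩ q) × ∣ p ∩ ∁ q ∣ ≡ k ∸ 2 × p ≡ (⁅ x ⁆ ∪ ⁅ y ⁆) ∪ (p ∩ ∁ q)
pair-trace⇒split {x = x} {y = y} {p = p} {q = q} {k} x≢y ∣p∣≡k trace =
  T∩q-empty , ∣T∣≡k∸2 , p≡pair∪T
  where
  T : Subset _
  T = p ∩ ∁ q

  p≡pair∪T : p ≡ (⁅ x ⁆ ∪ ⁅ y ⁆) ∪ T
  p≡pair∪T = trans (p≡[p∩q]∪[p∩∁q] p q) (cong (_∪ T) trace)

  T∩q-empty : Empty (T ∩ q)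
  T∩q-empty = subst Empty (∩-comm q T) (⊆-∁⇒Empty-∩ ⊆-refl (p∩q⊆q p (∁ q)))

  pair∩T-empty : Empty ((⁅ x ⁆ ∪ ⁅ y ⁆) ∩ T)
  pair∩T-empty = ⊆-∁⇒Empty-∩ (subst (_⊆ q) trace (p∩q⊆q p q)) (p∩q⊆q p (∁ q))

  ∣T∣≡k∸2 : ∣ T ∣ ≡ k ∸ 2
  ∣T∣≡k∸2 = begin
    ∣ T ∣                           ≡⟨ sym (m+n∸m≡n 2 ∣ T ∣) ⟩
    2 + ∣ T ∣ ∸ 2                   ≡⟨ cong (_∸ 2) (sym (∣[⁅x⁆∪⁅y⁆]∪p∣≡2+∣p∣ x≢y pair∩T-empty)) ⟩
    ∣ (⁅ x ⁆ ∪ ⁅ y ⁆) ∪ T ∣ ∸ 2     ≡⟨ cong (λ s → ∣ s ∣ ∸ 2) (sym p≡pair∪T) ⟩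
    ∣ p ∣ ∸ 2                       ≡⟨ cong (_∸ 2) ∣p∣≡k ⟩
    k ∸ 2                           ∎

subset-ofSize : ∀ (p : Subset n) {m} → m ≤ ∣ p ∣ → ∃ λ q → q ⊆ p × ∣ q ∣ ≡ m
subset-ofSize {n} p {zero} _ = ⊥ , ⊥⊆ , ∣⊥∣≡0 n
subset-ofSize (inside ∷ p) {suc m} (s≤s m≤∣p∣) =
  let q , q⊆p , ∣q∣≡m = subset-ofSize p m≤∣p∣ in inside ∷ q , s⊆s q⊆p , cong suc ∣q∣≡m
subset-ofSize (outside ∷ p) {suc m} m≤∣p∣ =
  let q , q⊆p , ∣q∣≡m = subset-ofSize p m≤∣p∣ in outside ∷ q , s⊆s q⊆p , ∣q∣≡m

k∸2≤n∸3 : ∀ {n k} → 2 ≤ k → 2 * k ≤ n → k ∸ 2 ≤ n ∸ 3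
k∸2≤n∸3 {n} {suc (suc j)} (s≤s (s≤s z≤n)) 2k≤n = m+n≤o⇒m≤o∸n j (≤-trans j+3≤2k 2k≤n)
  where
  j+3≤2k : j + 3 ≤ 2 * (2 + j)
  j+3≤2k = ≤-trans (≤-reflexive (+-comm j 3))
    (s≤s (s≤s (≤-trans (s≤s (m≤m+n j _)) (≤-reflexive (sym (+-suc j _))))))

a≤b⇒[k∸a]⊓[k∸b]≡k∸b : ∀ k {a b} → a ≤ b → (k ∸ a) ⊓ (k ∸ b) ≡ k ∸ b
a≤b⇒[k∸a]⊓[k∸b]≡k∸b k a≤b = m≥n⇒m⊓n≡n (∸-monoʳ-≤ k a≤b)

-- a, b, c count the points x, y, z in a vertex W and r = |R ∩ W|; the two minima are then
-- the distances from W to the edges AB and CB.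
resolving-counts : ∀ k a b c r →
  (k ∸ (b + c + r)) ⊓ (k ∸ (a + b + r)) ≢ (k ∸ (a + c + r)) ⊓ (k ∸ (a + b + r)) →
  c ≢ 0 × a ≢ b
resolving-counts k a b c r resolved = c≢0 , a≢b
  where
  c≢0 : c ≢ 0
  c≢0 refl = resolved (trans (a≤b⇒[k∸a]⊓[k∸b]≡k∸b k b+0+r≤a+b+r)
                             (sym (a≤b⇒[k∸a]⊓[k∸b]≡k∸b k a+0+r≤a+b+r)))
    where
    b+0+r≤a+b+r : b + 0 + r ≤ a + b + r
    b+0+r≤a+b+r = +-monoˡ-≤ r (≤-trans (≤-reflexive (+-identityʳ b)) (m≤n+m b a))
    a+0+r≤a+b+r : a + 0 + r ≤ a + b + r
    a+0+r≤a+b+r = +-monoˡ-≤ r (+-monoʳ-≤ a z≤n)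

  a≢b : a ≢ b
  a≢b refl = resolved refl

module ResolvingPair {n k : ℕ} (k≥2 : 2 ≤ k) {x y z : Fin n}
  (x≢y : x ≢ y) (x≢z : x ≢ z) (y≢z : y ≢ z)
  {R : Subset n} (R⊆∁S : R ⊆ ∁ (⁅ x ⁆ ∪ (⁅ y ⁆ ∪ ⁅ z ⁆))) (∣R∣≡k∸2 : ∣ R ∣ ≡ k ∸ 2) where

  S : Subset n
  S = ⁅ x ⁆ ∪ (⁅ y ⁆ ∪ ⁅ z ⁆)

  x∈S : x ∈ S
  x∈S = x∈p∪q⁺ (inj₁ (x∈⁅x⁆ x))

  y∈S : y ∈ S
  y∈S = x∈p∪q⁺ (inj₂ (x∈p∪q⁺ (inj₁ (x∈⁅x⁆ y))))

  z∈S : z ∈ S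
  z∈S = x∈p∪q⁺ (inj₂ (x∈p∪q⁺ (inj₂ (x∈⁅x⁆ z))))

  ∈S⇒∉R : ∀ {t} → t ∈ S → t ∉ R
  ∈S⇒∉R t∈S t∈R = x∈∁p⇒x∉p (R⊆∁S t∈R) t∈S

  module _ {u v : Fin n} (u≢v : u ≢ v) (u∈S : u ∈ S) (v∈S : v ∈ S) where

    pair∩R-empty : Empty ((⁅ u ⁆ ∪ ⁅ v ⁆) ∩ R)
    pair∩R-empty = ⊆-∁⇒Empty-∩ (⁅x⁆∪⁅y⁆⊆p u∈S v∈S) R⊆∁S

    pairVertex : Vertex n k
    pairVertex = (⁅ u ⁆ ∪ ⁅ v ⁆) ∪ R , (begin
      ∣ (⁅ u ⁆ ∪ ⁅ v ⁆) ∪ R ∣  ≡⟨ ∣[⁅x⁆∪⁅y⁆]∪p∣≡2+∣p∣ u≢v pair∩R-empty ⟩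
      2 + ∣ R ∣                ≡⟨ cong (2 +_) ∣R∣≡k∸2 ⟩
      2 + (k ∸ 2)              ≡⟨ m+[n∸m]≡n k≥2 ⟩
      k                        ∎)

    ∣pairVertex∩w∣ : ∀ w → ∣ proj₁ pairVertex ∩ w ∣ ≡ ∣ ⁅ u ⁆ ∩ w ∣ + ∣ ⁅ v ⁆ ∩ w ∣ + ∣ R ∩ w ∣
    ∣pairVertex∩w∣ = ∣[⁅x⁆∪⁅y⁆∪p]∩q∣ u≢v pair∩R-empty

    u∈pairVertex : u ∈ proj₁ pairVertex
    u∈pairVertex = x∈p∪q⁺ (inj₁ (x∈p∪q⁺ (inj₁ (x∈⁅x⁆ u))))

    v∈pairVertex : v ∈ proj₁ pairVertex
    v∈pairVertex = x∈p∪q⁺ (inj₁ (x∈p∪q⁺ (inj₂ (x∈⁅x⁆ v))))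

    ∉pairVertex : ∀ {t} → t ∈ S → t ≢ u → t ≢ v → t ∉ proj₁ pairVertex
    ∉pairVertex t∈S t≢u t≢v =
      x∉p∪q (x∉p∪q (x≢y⇒x∉⁅y⁆ t≢u) (x≢y⇒x∉⁅y⁆ t≢v)) (∈S⇒∉R t∈S)

    adjacent : (w : Vertex n k) → R ⊆ proj₁ w → u ∈ proj₁ w → v ∉ proj₁ w → Adjacent pairVertex w
    adjacent (w , _) R⊆w u∈w v∉w = begin
      ∣ proj₁ pairVertex ∩ w ∣                 ≡⟨ ∣pairVertex∩w∣ w ⟩
      ∣ ⁅ u ⁆ ∩ w ∣ + ∣ ⁅ v ⁆ ∩ w ∣ + ∣ R ∩ w ∣ ≡⟨ cong₂ _+_
                                                    (cong₂ _+_ (∣⁅x⁆∩p∣≡1 u∈w) (∣⁅x⁆∩p∣≡0 v∉w))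
                                                    (cong ∣_∣ (p⊆q⇒p∩q≡p R⊆w)) ⟩
      1 + ∣ R ∣                                ≡⟨ cong (1 +_) ∣R∣≡k∸2 ⟩
      1 + (k ∸ 2)                              ≡⟨ sym (+-∸-assoc 1 k≥2) ⟩
      k ∸ 1                                    ∎

  A B C : Vertex n k
  A = pairVertex y≢z y∈S z∈S
  B = pairVertex x≢y x∈S y∈S
  C = pairVertex x≢z x∈S z∈S

  z∉B : z ∉ proj₁ B
  z∉B = ∉pairVertex x≢y x∈S y∈S z∈S (≢-sym x≢z) (≢-sym y≢z)

  R⊆B : R ⊆ proj₁ B
  R⊆B = q⊆p∪q (⁅ x ⁆ ∪ ⁅ y ⁆) R

  e₁ e₂ : Edge n k
  e₁ = (A , B) , adjacent y≢z y∈S z∈S B R⊆B (v∈pairVertex x≢y x∈S y∈S) z∉B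
  e₂ = (C , B) , adjacent x≢z x∈S z∈S B R⊆B (u∈pairVertex x≢y x∈S y∈S) z∉B

  e₁≉e₂ : ¬ SameEdge e₁ e₂
  e₁≉e₂ (inj₁ (A≡C , _)) =
    ∉pairVertex x≢z x∈S z∈S y∈S (≢-sym x≢y) y≢z
      (subst (λ w → y ∈ proj₁ w) A≡C (u∈pairVertex y≢z y∈S z∈S))
  e₁≉e₂ (inj₂ (A≡B , _)) = z∉B (subst (λ w → z ∈ proj₁ w) A≡B (v∈pairVertex y≢z y∈S z∈S))

  resolver-membership : (w : Vertex n k) → edgeDist e₁ w ≢ edgeDist e₂ w →
    z ∈ proj₁ w × (x ∈ proj₁ w × y ∉ proj₁ w ⊎ x ∉ proj₁ w × y ∈ proj₁ w)
  resolver-membership (w , _) resolved =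
    let c≢0 , a≢b = resolving-counts k a b c ρ resolved′
    in ∣⁅x⁆∩p∣≢0⇒x∈p c≢0 , ∣⁅x⁆∩p∣≢∣⁅y⁆∩p∣ a≢b
    where
    a b c ρ : ℕ
    a = ∣ ⁅ x ⁆ ∩ w ∣
    b = ∣ ⁅ y ⁆ ∩ w ∣
    c = ∣ ⁅ z ⁆ ∩ w ∣
    ρ = ∣ R ∩ w ∣

    min-dist : ℕ → ℕ → ℕ
    min-dist s t = (k ∸ s) ⊓ (k ∸ t)

    ∣A∩w∣ : ∣ proj₁ A ∩ w ∣ ≡ b + c + ρ
    ∣A∩w∣ = ∣pairVertex∩w∣ y≢z y∈S z∈S w
    ∣B∩w∣ : ∣ proj₁ B ∩ w ∣ ≡ a + b + ρ
    ∣B∩w∣ = ∣pairVertex∩w∣ x≢y x∈S y∈S w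
    ∣C∩w∣ : ∣ proj₁ C ∩ w ∣ ≡ a + c + ρ
    ∣C∩w∣ = ∣pairVertex∩w∣ x≢z x∈S z∈S w

    resolved′ : min-dist (b + c + ρ) (a + b + ρ) ≢ min-dist (a + c + ρ) (a + b + ρ)
    resolved′ eq = resolved (begin
      min-dist (∣ proj₁ A ∩ w ∣) (∣ proj₁ B ∩ w ∣)  ≡⟨ cong₂ min-dist ∣A∩w∣ ∣B∩w∣ ⟩
      min-dist (b + c + ρ) (a + b + ρ)              ≡⟨ eq ⟩
      min-dist (a + c + ρ) (a + b + ρ)              ≡⟨ sym (cong₂ min-dist ∣C∩w∣ ∣B∩w∣) ⟩
      min-dist (∣ proj₁ C ∩ w ∣) (∣ proj₁ B ∩ w ∣)  ∎)

  w∩S≡ : ∀ w → w ∩ S ≡ (⁅ x ⁆ ∩ w) ∪ ((⁅ y ⁆ ∩ w) ∪ (⁅ z ⁆ ∩ w))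
  w∩S≡ w = begin
    w ∩ S                                         ≡⟨ ∩-comm w S ⟩
    S ∩ w                                         ≡⟨ ∩-distribʳ-∪ w ⁅ x ⁆ (⁅ y ⁆ ∪ ⁅ z ⁆) ⟩
    (⁅ x ⁆ ∩ w) ∪ ((⁅ y ⁆ ∪ ⁅ z ⁆) ∩ w)           ≡⟨ cong ((⁅ x ⁆ ∩ w) ∪_) (∩-distribʳ-∪ w ⁅ y ⁆ ⁅ z ⁆) ⟩
    (⁅ x ⁆ ∩ w) ∪ ((⁅ y ⁆ ∩ w) ∪ (⁅ z ⁆ ∩ w))     ∎

  resolver∈S' : (w : Vertex n k) → edgeDist e₁ w ≢ edgeDist e₂ w → InS' x y z w
  resolver∈S' (w , ∣w∣≡k) resolved with resolver-membership (w , ∣w∣≡k) resolved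
  ... | z∈w , inj₁ (x∈w , y∉w) =
    let T∩S-empty , ∣T∣≡k∸2 , w≡[x,z]∪T = pair-trace⇒split x≢z ∣w∣≡k trace
    in w ∩ ∁ S , T∩S-empty , ∣T∣≡k∸2 , inj₁ w≡[x,z]∪T
    where
    trace : w ∩ S ≡ ⁅ x ⁆ ∪ ⁅ z ⁆
    trace = begin
      w ∩ S                   ≡⟨ w∩S≡ w ⟩
      _                       ≡⟨ cong₂ _∪_ (x∈p⇒⁅x⁆∩p≡⁅x⁆ x∈w)
                                           (cong₂ _∪_ (x∉p⇒⁅x⁆∩p≡⊥ y∉w) (x∈p⇒⁅x⁆∩p≡⁅x⁆ z∈w)) ⟩
      ⁅ x ⁆ ∪ (⊥ ∪ ⁅ z ⁆)     ≡⟨ cong (⁅ x ⁆ ∪_) (∪-identityˡ ⁅ z ⁆) ⟩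
      ⁅ x ⁆ ∪ ⁅ z ⁆           ∎
  ... | z∈w , inj₂ (x∉w , y∈w) =
    let T∩S-empty , ∣T∣≡k∸2 , w≡[y,z]∪T = pair-trace⇒split y≢z ∣w∣≡k trace
    in w ∩ ∁ S , T∩S-empty , ∣T∣≡k∸2 , inj₂ w≡[y,z]∪T
    where
    trace : w ∩ S ≡ ⁅ y ⁆ ∪ ⁅ z ⁆
    trace = begin
      w ∩ S                   ≡⟨ w∩S≡ w ⟩
      _                       ≡⟨ cong₂ _∪_ (x∉p⇒⁅x⁆∩p≡⊥ x∉w)
                                           (cong₂ _∪_ (x∈p⇒⁅x⁆∩p≡⁅x⁆ y∈w) (x∈p⇒⁅x⁆∩p≡⁅x⁆ z∈w)) ⟩
      ⊥ ∪ (⁅ y ⁆ ∪ ⁅ z ⁆)     ≡⟨ ∪-identityˡ (⁅ y ⁆ ∪ ⁅ z ⁆) ⟩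
      ⁅ y ⁆ ∪ ⁅ z ⁆           ∎

edgeResolving⇒hitting : ∀ {n k} → 2 ≤ k → 2 * k ≤ n →
  (N : VertexSet n k) → IsEdgeResolving N → IsHittingSet N
edgeResolving⇒hitting {n} {k} k≥2 2k≤n N resolving x y z x≢y x≢z y≢z =
  let R , R⊆∁S , ∣R∣≡k∸2 = subset-ofSize (∁ S) k∸2≤∣∁S∣
      open ResolvingPair k≥2 x≢y x≢z y≢z R⊆∁S ∣R∣≡k∸2
      w , w∈N , resolved = resolving e₁ e₂ e₁≉e₂
  in w , w∈N , resolver∈S' w resolved
  where
  S : Subset n
  S = ⁅ x ⁆ ∪ (⁅ y ⁆ ∪ ⁅ z ⁆)

  k∸2≤∣∁S∣ : k ∸ 2 ≤ ∣ ∁ S ∣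
  k∸2≤∣∁S∣ = subst (k ∸ 2 ≤_)
    (sym (trans (∣∁p∣≡n∸∣p∣ S) (cong (n ∸_) (∣⁅x⁆∪[⁅y⁆∪⁅z⁆]∣≡3 x≢y x≢z y≢z))))
    (k∸2≤n∸3 k≥2 2k≤n)

corollary4 : (n k : ℕ) → 2 ≤ k → 2 * k ≤ n →
    (b m : ℕ) → IsEdgeMetricDim n k b → IsMHSP n k m → m ≤ b
corollary4 n k k≥2 2k≤n b m ((N , resolving , ∣N∣≡b) , _) (_ , hitting-sets-≥m) =
  subst (m ≤_) ∣N∣≡b (hitting-sets-≥m N (edgeResolving⇒hitting k≥2 2k≤n N resolving))
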